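{- Let $G$ be a bush graph with exactly two distinct edge weights (and an arbitrary number of edges in each bush). Then the expected weight of the greedy matching returned by the algorithm \textsc{Rgma} on $G$ is at least $\frac{2}{3}\,\mathrm{OPT}(G)$.
   Context: Graphs are finite, simple, undirected, with positive edge weights; the weight of a matching is the sum of its edge weights. With distinct edge weights $w_1>\dots>w_\ell$, a greedy matching is any matching that can be output by: $\mathcal{M}\leftarrow\emptyset$; for $i=1,\dots,\ell$, while the current edge set contains an edge of weight $w_i$, pick any such edge $e^*$, add it to $\mathcal{M}$ and delete all edges sharing an endpoint with $e^*$. $\mathrm{OPT}(G)$ is the maximum weight of a greedy matching of $G$. $G$ is a bush graph if for every $i$ the edges of weight $w_i$ form a star (all share a common vertex, the center); this star is the $i$-th bush. Algorithm \textsc{Rgma} on a bush graph: $\mathcal{M}\leftarrow\emptyset$; for $i=1,\dots,\ell$: let $G_i$ be the set of edges of weight $w_i$ still present in the current graph; if $G_i\neq\emptyset$, select an edge $e_i\in G_i$ uniformly at random, add it to $\mathcal{M}$, and delete from the current graph both endpoints of $e_i$ (with their incident edges) and all edges of $G_i$. Output $\mathcal{M}$.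
   Formalization: The edge weights are rational. -}

module Defs where

open import Data.Nat as ℕ using (ℕ; zero; suc; _≡ᵇ_)
open import Data.Integer using (+_)
open import Data.Rational using (ℚ; 0ℚ; _+_; _*_; _/_; _<_; _≤_)
open import Data.List using (List; []; _∷_; filterᵇ; map; length)
open import Data.Bool.ListAction using (any)
open import Data.List.Membership.Propositional using (_∈_; _∉_)
open import Data.List.Relation.Unary.Unique.Propositional using (Unique)
open import Data.Bool using (Bool; true; false; if_then_else_; not)
open import Data.Product using (_×_)
open import Data.Sum using (_⊎_)
open import Relation.Binary.PropositionalEquality using (_≡_)
open import Relation.Nullary using (¬_)

-- Vertices are natural numbers.  A bush is a star: a center, a list of
-- leaves (the other endpoints of its edges) and the common weight.
record Bush : Set where
  constructor bush
  field
    center : ℕ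
    leaves : List ℕ
    weight : ℚ
open Bush public

record WellFormedBush (b : Bush) : Set where
  field
    nonempty : ¬ (leaves b ≡ [])
    noLoop   : center b ∉ leaves b
    distinct : Unique (leaves b)

SameEdge : ℕ → ℕ → ℕ → ℕ → Set
SameEdge a b c d = (a ≡ c × b ≡ d) ⊎ (a ≡ d × b ≡ c)

-- two bushes share no edge (the graph is simple: one weight per edge)
EdgeDisjoint : Bush → Bush → Set
EdgeDisjoint b₁ b₂ = ∀ {u v} → u ∈ leaves b₁ → v ∈ leaves b₂ →
  ¬ SameEdge (center b₁) u (center b₂) v

memᵇ : ℕ → List ℕ → Bool
memᵇ v R = any (v ≡ᵇ_) R

-- leaves u such that the edge {center b, u} is still present after
-- deleting the vertices in R (with all their incident edges)
live : List ℕ → Bush → List ℕ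
live R b = if memᵇ (center b) R then [] else filterᵇ (λ u → not (memᵇ u R)) (leaves b)

sumℚ : List ℚ → ℚ
sumℚ [] = 0ℚ
sumℚ (x ∷ xs) = x + sumℚ xs

avg : List ℚ → ℚ
avg [] = 0ℚ
avg (x ∷ xs) = sumℚ (x ∷ xs) * ((+ 1) / suc (length xs))

-- Expected weight of the matching output by Rgma, processing the bushes
-- in the given order (decreasing weight), starting with deleted set R.
expectedRgma : List Bush → List ℕ → ℚ
expectedRgma [] R = 0ℚ
expectedRgma (b ∷ bs) R with live R b
... | [] = expectedRgma bs R
... | (l ∷ ls) = avg (map (λ u → weight b + expectedRgma bs (center b ∷ u ∷ R)) (l ∷ ls))

-- GreedyRun bs R x : some run of the greedy algorithm on bushes bs
-- (in decreasing weight order), with the vertices of R already deleted,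
-- outputs a matching of weight x.  The while-loop of each weight class
-- is modelled literally: pick any present edge of the current weight,
-- delete its endpoints, repeat until no edge of that weight remains.
data GreedyRun : List Bush → List ℕ → ℚ → Set where
  done : ∀ {R} → GreedyRun [] R 0ℚ
  next : ∀ {b bs R x} → live R b ≡ [] → GreedyRun bs R x → GreedyRun (b ∷ bs) R x
  pick : ∀ {b bs R x u} → u ∈ live R b →
         GreedyRun (b ∷ bs) (center b ∷ u ∷ R) x →
         GreedyRun (b ∷ bs) R (weight b + x)

module Submission where

-- Let b₁, b₂ be the bushes of weights w₁ > w₂ > 0
-- with centers c₁, c₂.  A greedy run picks one leaf u of b₁ (which deletes
-- c₁, so nothing else of b₁ survives) and then at most one edge {c₂, v} of
-- b₂.  Rgma picks a uniformly random leaf z of b₁ and then gains w₂ whenever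
-- some edge of b₂ survives the deletion of {c₁, z}; in particular it gains w₂
-- for every z ∉ {c₂, v}, and u is such a z.  Measured against the target
-- t = (2/3)·x, the deficit (w₁ + gain z) - t of an outcome z is then at least
-- -w₂/3 for every z, non-negative for z ∉ {c₂, v}, and at least 2w₂/3 for
-- z = u.  As the leaves are distinct, at most two outcomes are exceptional,
-- so the total deficit is non-negative, i.e. t is at most the average.

open import Defs
open import Data.Bool using (true; false; not; T)
open import Data.Bool.Properties using (T-not-≡)
open import Data.Empty using (⊥-elim)
open import Data.Integer using (+_)
open import Data.List using (List; []; _∷_; map; length)
open import Data.List.Membership.Propositional using (_∈_; _∉_)
open import Data.List.Membership.Propositional.Properties using (∈-filter⁺; ∈-filter⁻)
open import Data.List.Properties using (map-∘; map-cong-local; filter-all)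
import Data.List.Relation.Unary.All as All
open import Data.List.Relation.Unary.Any as Any using (here; there)
open import Data.List.Relation.Unary.Any.Properties using (any⁺; any⁻)
open import Data.List.Relation.Unary.AllPairs using ([]; _∷_)
open import Data.List.Relation.Unary.Unique.Propositional using (Unique)
open import Data.Nat as ℕ using (ℕ; suc; _≡ᵇ_)
open import Data.Nat.Properties using (≡ᵇ⇒≡; ≡⇒≡ᵇ)
import Data.Nat.Properties as ℕₚ
import Data.Nat.Coprimality as Coprimality
open import Data.Product using (_×_; _,_; proj₁; proj₂)
open import Data.Rational using (ℚ; 0ℚ; 1ℚ; mkℚ; _+_; _-_; -_; _*_; _/_; 1/_; _<_; _≤_)
open import Data.Rational.Properties
  using (≤-refl; ≤-trans; ≤-reflexive; <⇒≤; +-mono-≤; +-monoˡ-≤; +-monoʳ-≤;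
         +-assoc; +-identityˡ; +-identityʳ; +-inverseˡ; +-inverseʳ;
         *-assoc; *-identityʳ; *-inverseʳ; *-monoʳ-≤-nonNeg; *-monoˡ-≤-nonNeg;
         normalize-coprime; toℚᵘ-injective; toℚᵘ-homo-+; module ≤-Reasoning)
import Data.Rational.Unnormalised as ℚᵘ
import Data.Rational.Unnormalised.Properties as ℚᵘ
open import Data.Rational.Solver using (module +-*-Solver)
open import Function using (_∘_; Equivalence)
open import Relation.Binary.Definitions using (DecidableEquality)
open import Relation.Binary.PropositionalEquality
  using (_≡_; _≢_; refl; sym; trans; cong; subst; subst₂; module ≡-Reasoning)
open import Relation.Nullary using (yes; no)
open import Relation.Nullary.Decidable using (T?)

open +-*-Solver

≤⇒0≤- : ∀ {p q} → p ≤ q → 0ℚ ≤ q - p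
≤⇒0≤- {p} {q} p≤q = subst (_≤ q - p) (+-inverseʳ p) (+-monoˡ-≤ (- p) p≤q)

0≤-⇒≤ : ∀ {p q} → 0ℚ ≤ q - p → p ≤ q
0≤-⇒≤ {p} {q} 0≤q-p = subst₂ _≤_ (+-identityˡ p) (solve 2 (λ p q → (q :- p) :+ p := q) refl p q)
  (+-monoˡ-≤ p 0≤q-p)

≤-+⇒0≤ : ∀ {q r} → r ≤ q + r → 0ℚ ≤ q
≤-+⇒0≤ {q} {r} r≤q+r =
  subst (0ℚ ≤_) (solve 2 (λ q r → (q :+ r) :- r := q) refl q r) (≤⇒0≤- r≤q+r)

sucℚ : ℕ → ℚ
sucℚ k = mkℚ (+ suc k) 0 (Coprimality.sym (Coprimality.1-coprimeTo (suc k)))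

sucℚ-suc : ∀ k → 1ℚ + sucℚ k ≡ sucℚ (suc k)
sucℚ-suc k = toℚᵘ-injective
  (ℚᵘ.≃-trans (toℚᵘ-homo-+ 1ℚ (sucℚ k))
              (ℚᵘ.*≡* (cong (λ n → + suc (suc n)) (ℕₚ.*-identityʳ (k ℕ.* 1)))))

avg-factor : ∀ k → (+ 1) / suc k ≡ 1/ sucℚ k
avg-factor k = normalize-coprime (Coprimality.1-coprimeTo (suc k))

deviation-sum : ∀ t x xs →
  sumℚ (map (_- t) (x ∷ xs)) ≡ sumℚ (x ∷ xs) - t * sucℚ (length xs)
deviation-sum t x [] = solve 2 (λ x t → (x :- t) :+ con 0ℚ := (x :+ con 0ℚ) :- t :* con 1ℚ) refl x t
deviation-sum t x (y ∷ ys) = begin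
  (x - t) + sumℚ (map (_- t) (y ∷ ys))  ≡⟨ cong (λ s → (x - t) + s) (deviation-sum t y ys) ⟩
  (x - t) + (S - t * n)                 ≡⟨ solve 4 (λ x t S n → (x :- t) :+ (S :- t :* n)
                                                   := (x :+ S) :- t :* (con 1ℚ :+ n)) refl x t S n ⟩
  (x + S) - t * (1ℚ + n)                ≡⟨ cong (λ k → (x + S) - t * k) (sucℚ-suc (length ys)) ⟩
  (x + S) - t * sucℚ (length (y ∷ ys))  ∎
  where
  open ≡-Reasoning
  S = sumℚ (y ∷ ys)
  n = sucℚ (length ys)

avg-≥ : ∀ t x xs → 0ℚ ≤ sumℚ (map (_- t) (x ∷ xs)) → t ≤ avg (x ∷ xs)
avg-≥ t x xs deviation≥0 = begin
  t                  ≡⟨ sym (trans (*-assoc t n (1/ n)) (trans (cong (t *_) (*-inverseʳ n)) (*-identityʳ t))) ⟩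
  t * n * (1/ n)     ≤⟨ *-monoʳ-≤-nonNeg (1/ n) tn≤S ⟩
  S * (1/ n)         ≡⟨ cong (S *_) (sym (avg-factor (length xs))) ⟩
  avg (x ∷ xs)       ∎
  where
  open ≤-Reasoning
  S = sumℚ (x ∷ xs)
  n = sucℚ (length xs)
  tn≤S : t * n ≤ S
  tn≤S = 0≤-⇒≤ (subst (0ℚ ≤_) (deviation-sum t x xs) deviation≥0)

sumOver : {A : Set} → (A → ℚ) → List A → ℚ
sumOver f L = sumℚ (map f L)

avg-map-≥ : ∀ {A : Set} {t} (f : A → ℚ) {l ls} →
  0ℚ ≤ sumOver (λ z → f z - t) (l ∷ ls) → t ≤ avg (map f (l ∷ ls))
avg-map-≥ {t = t} f {l} {ls} deviation≥0 =
  avg-≥ t (f l) (map f ls) (subst (0ℚ ≤_) (cong sumℚ (map-∘ {g = _- t} {f = f} (l ∷ ls))) deviation≥0)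

sum-nonneg : ∀ {A : Set} {f : A → ℚ} L → (∀ {z} → z ∈ L → 0ℚ ≤ f z) → 0ℚ ≤ sumOver f L
sum-nonneg []      _      = ≤-refl
sum-nonneg (u ∷ L) f≥0 = +-mono-≤ (f≥0 (here refl)) (sum-nonneg L (f≥0 ∘ there))

avg-map-≥-pointwise : ∀ {A : Set} {t} (f : A → ℚ) {l ls} →
  (∀ {z} → z ∈ l ∷ ls → t ≤ f z) → t ≤ avg (map f (l ∷ ls))
avg-map-≥-pointwise f {l} {ls} t≤f = avg-map-≥ f {l} {ls} (sum-nonneg (l ∷ ls) (≤⇒0≤- ∘ t≤f))

term≤sum : ∀ {A : Set} {f : A → ℚ} {g L} → g ∈ L → (∀ {z} → z ∈ L → 0ℚ ≤ f z) → f g ≤ sumOver f L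
term≤sum {f = f} {g} {_ ∷ L} (here refl) f≥0 =
  subst (_≤ f g + sumOver f L) (+-identityʳ (f g)) (+-monoʳ-≤ (f g) (sum-nonneg L (f≥0 ∘ there)))
term≤sum {f = f} {g} {u ∷ L} (there g∈L) f≥0 =
  subst (_≤ f u + sumOver f L) (+-identityˡ (f g)) (+-mono-≤ (f≥0 (here refl)) (term≤sum g∈L (f≥0 ∘ there)))

sum-cong : ∀ {A : Set} {f g : A → ℚ} L → (∀ {z} → z ∈ L → f z ≡ g z) → sumOver f L ≡ sumOver g L
sum-cong L f≡g = cong sumℚ (map-cong-local (All.tabulate f≡g))

⅔ ⅓ : ℚ
⅔ = (+ 2) / 3
⅓ = (+ 1) / 3

⅓*-nonneg : ∀ {p} → 0ℚ ≤ p → 0ℚ ≤ ⅓ * p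
⅓*-nonneg = *-monoˡ-≤-nonNeg ⅓

≤-+ˡ : ∀ {p r} → 0ℚ ≤ p → r ≤ p + r
≤-+ˡ {p} {r} 0≤p = subst (_≤ p + r) (+-identityˡ r) (+-monoˡ-≤ r 0≤p)

-- One greedy pick of weight w₁: every outcome already reaches (2/3)·w₁.
one-pick-bound : ∀ {A : Set} {w₁} (E : A → ℚ) {l ls} → 0ℚ ≤ w₁ → (∀ z → 0ℚ ≤ E z) →
  ⅔ * (w₁ + 0ℚ) ≤ avg (map (λ z → w₁ + E z) (l ∷ ls))
one-pick-bound {w₁ = w₁} E {l} {ls} w₁≥0 E≥0 = avg-map-≥-pointwise (λ z → w₁ + E z) {l} {ls} λ {z} _ →
  0≤-⇒≤ (subst (0ℚ ≤_)
    (sym (solve 2 (λ w e → (w :+ e) :- con ⅔ :* (w :+ con 0ℚ) := con ⅓ :* w :+ e) refl w₁ (E z)))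
    (+-mono-≤ (⅓*-nonneg w₁≥0) (E≥0 z)))

module Exceptions {A : Set} (_≟_ : DecidableEquality A) where

  raise : A → ℚ → (A → ℚ) → A → ℚ
  raise x c f z with z ≟ x
  ... | yes _ = f z + c
  ... | no  _ = f z

  raise-≢ : ∀ {x c f z} → z ≢ x → raise x c f z ≡ f z
  raise-≢ {x} {z = z} z≢x with z ≟ x
  ... | yes z≡x = ⊥-elim (z≢x z≡x)
  ... | no  _   = refl

  raise-≥ : ∀ {x c f z} → 0ℚ ≤ c → f z ≤ raise x c f z
  raise-≥ {x} {c} {f} {z} c≥0 with z ≟ x
  ... | yes _ = subst (_≤ f z + c) (+-identityʳ (f z)) (+-monoʳ-≤ (f z) c≥0)
  ... | no  _ = ≤-refl

  sum-raise : ∀ {x c f} L → 0ℚ ≤ c → Unique L → sumOver (raise x c f) L ≤ sumOver f L + c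
  sum-raise {c = c} [] c≥0 [] = subst (0ℚ ≤_) (sym (+-identityˡ c)) c≥0
  sum-raise {x} {c} {f} (u ∷ L) c≥0 (u∉L ∷ unique) with u ≟ x
  ... | yes refl = ≤-reflexive (begin
    (f u + c) + sumOver (raise u c f) L ≡⟨ cong (λ s → (f u + c) + s) (sum-cong L rest-unraised) ⟩
    (f u + c) + sumOver f L             ≡⟨ solve 3 (λ a c s → (a :+ c) :+ s := (a :+ s) :+ c)
                                                   refl (f u) c (sumOver f L) ⟩
    (f u + sumOver f L) + c             ∎)
    where
    open ≡-Reasoning
    -- u occurs only once, so the raise does not affect the tail
    rest-unraised : ∀ {z} → z ∈ L → raise u c f z ≡ f z
    rest-unraised z∈L = raise-≢ (λ z≡u → All.lookup u∉L z∈L (sym z≡u))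
  ... | no  _    = subst (f u + sumOver (raise x c f) L ≤_) (sym (+-assoc (f u) (sumOver f L) c))
                     (+-monoʳ-≤ (f u) (sum-raise L c≥0 unique))

  sum-with-exceptions : ∀ {m f g} L (X : List A) → 0ℚ ≤ m → Unique L → g ∈ L → g ∉ X →
    (∀ {z} → z ∈ L → - m ≤ f z) → (∀ {z} → z ∈ L → z ∉ X → 0ℚ ≤ f z) →
    f g ≤ sumOver f L + sumOver (λ _ → m) X
  sum-with-exceptions {f = f} {g} L [] _ _ g∈L _ _ f≥0 =
    subst (f g ≤_) (sym (+-identityʳ (sumOver f L))) (term≤sum g∈L (λ z∈L → f≥0 z∈L λ ()))
  sum-with-exceptions {m} {f} {g} L (x ∷ X) m≥0 unique g∈L g∉X f≥-m f≥0 = begin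
    f g                                              ≡⟨ sym (raise-≢ (g∉X ∘ here)) ⟩
    raise x m f g                                    ≤⟨ sum-with-exceptions L X m≥0 unique g∈L (g∉X ∘ there)
                                                          (λ z∈L → ≤-trans (f≥-m z∈L) (raise-≥ m≥0)) raised≥0 ⟩
    sumOver (raise x m f) L + sumOver (λ _ → m) X    ≤⟨ +-monoˡ-≤ (sumOver (λ _ → m) X)
                                                          (sum-raise L m≥0 unique) ⟩
    (sumOver f L + m) + sumOver (λ _ → m) X          ≡⟨ +-assoc (sumOver f L) m (sumOver (λ _ → m) X) ⟩
    sumOver f L + sumOver (λ _ → m) (x ∷ X)          ∎
    where
    open ≤-Reasoning
    -- after raising x by m, the only exceptions left are those in X
    raised≥0 : ∀ {z} → z ∈ L → z ∉ X → 0ℚ ≤ raise x m f z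
    raised≥0 {z} z∈L z∉X with z ≟ x
    ... | yes _   = subst (_≤ f z + m) (+-inverseˡ m) (+-monoˡ-≤ m (f≥-m z∈L))
    ... | no  z≢x = f≥0 z∈L λ { (here z≡x) → z≢x z≡x ; (there z∈X) → z∉X z∈X }

  -- Two greedy picks of weights w₁ ≥ w₂ ≥ 0: an outcome z gaining w₂ beats
  -- the target t = (2/3)(w₁ + w₂) by at least 2m (m = w₂/3), every outcome
  -- misses it by at most m, and only a and b may fail to gain w₂.  The leaf
  -- u, which does gain w₂, pays for both exceptions.
  two-picks-bound : ∀ {w₁ w₂} (E : A → ℚ) {a b u l ls} → 0ℚ ≤ w₂ → w₂ ≤ w₁ →
    Unique (l ∷ ls) → u ∈ l ∷ ls → u ∉ a ∷ b ∷ [] →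
    (∀ z → 0ℚ ≤ E z) → (∀ z → z ∉ a ∷ b ∷ [] → w₂ ≤ E z) →
    ⅔ * (w₁ + (w₂ + 0ℚ)) ≤ avg (map (λ z → w₁ + E z) (l ∷ ls))
  two-picks-bound {w₁} {w₂} E {a} {b} {u} {l} {ls} w₂≥0 w₂≤w₁ unique u∈L u∉ab E≥0 E≥w₂ =
    avg-map-≥ (λ z → w₁ + E z) {l} {ls} (≤-+⇒0≤ (≤-trans (surplus u∉ab)
      (sum-with-exceptions (l ∷ ls) (a ∷ b ∷ []) m≥0 unique u∈L u∉ab
        (λ {z} _ → deficit≥-m z) (λ _ z∉ab → ≤-trans penalty≥0 (surplus z∉ab)))))
    where
    t m : ℚ
    t = ⅔ * (w₁ + (w₂ + 0ℚ))
    m = ⅓ * w₂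
    deficit : A → ℚ
    deficit z = (w₁ + E z) - t
    m≥0 : 0ℚ ≤ m
    m≥0 = ⅓*-nonneg w₂≥0
    penalty≥0 : 0ℚ ≤ m + (m + 0ℚ)
    penalty≥0 = +-mono-≤ m≥0 (+-mono-≤ m≥0 ≤-refl)
    gap≥0 : 0ℚ ≤ ⅓ * (w₁ - w₂)
    gap≥0 = ⅓*-nonneg (≤⇒0≤- w₂≤w₁)
    deficit≥-m : ∀ z → - m ≤ deficit z
    deficit≥-m z = subst (- m ≤_)
      (sym (solve 3 (λ w₁ w₂ e → (w₁ :+ e) :- con ⅔ :* (w₁ :+ (w₂ :+ con 0ℚ))
                                    := (con ⅓ :* (w₁ :- w₂) :+ e) :- con ⅓ :* w₂) refl w₁ w₂ (E z)))
      (≤-+ˡ (+-mono-≤ gap≥0 (E≥0 z)))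
    surplus : ∀ {z} → z ∉ a ∷ b ∷ [] → m + (m + 0ℚ) ≤ deficit z
    surplus {z} z∉ab = subst (m + (m + 0ℚ) ≤_)
      (sym (solve 3 (λ w₁ w₂ e → (w₁ :+ e) :- con ⅔ :* (w₁ :+ (w₂ :+ con 0ℚ))
                        := (con ⅓ :* (w₁ :- w₂) :+ (e :- w₂))
                           :+ (con ⅓ :* w₂ :+ (con ⅓ :* w₂ :+ con 0ℚ))) refl w₁ w₂ (E z)))
      (≤-+ˡ (+-mono-≤ gap≥0 (≤⇒0≤- (E≥w₂ z z∉ab))))

memᵇ-false⇒∉ : ∀ {v R} → memᵇ v R ≡ false → v ∉ R
memᵇ-false⇒∉ {v} e v∈R = subst T e (any⁺ (v ≡ᵇ_) (Any.map (≡⇒≡ᵇ v _) v∈R))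

∉⇒memᵇ-false : ∀ {v R} → v ∉ R → memᵇ v R ≡ false
∉⇒memᵇ-false {v} {R} v∉R with memᵇ v R in e
... | false = refl
... | true  = ⊥-elim (v∉R (Any.map (≡ᵇ⇒≡ v _) (any⁻ (v ≡ᵇ_) R (subst T (sym e) _))))

live-sound : ∀ {u} R b → u ∈ live R b → center b ∉ R × u ∈ leaves b × u ∉ R
live-sound {u} R b u∈live with memᵇ (center b) R in e
... | false = memᵇ-false⇒∉ e , u∈leaves , memᵇ-false⇒∉ (Equivalence.to T-not-≡ kept)
  where
  filtered = ∈-filter⁻ (T? ∘ λ w → not (memᵇ w R)) {xs = leaves b} u∈live
  u∈leaves = proj₁ filtered
  kept = proj₂ filtered

live-complete : ∀ {u} R b → center b ∉ R → u ∈ leaves b → u ∉ R → u ∈ live R b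
live-complete {u} R b c∉R u∈leaves u∉R
  with memᵇ (center b) R | ∉⇒memᵇ-false {center b} {R} c∉R
... | .false | refl = ∈-filter⁺ (T? ∘ λ w → not (memᵇ w R)) u∈leaves (Equivalence.from T-not-≡ (∉⇒memᵇ-false u∉R))

center-deleted : ∀ b {u R v} → v ∉ live (center b ∷ u ∷ R) b
center-deleted b {u} {R} v∈live = proj₁ (live-sound (center b ∷ u ∷ R) b v∈live) (here refl)

picked-not-endpoint : ∀ b c u {v} → v ∈ live (c ∷ u ∷ []) b → u ∉ center b ∷ v ∷ []
picked-not-endpoint b c u v∈live (here u≡c)          = proj₁ (live-sound (c ∷ u ∷ []) b v∈live) (there (here (sym u≡c)))
picked-not-endpoint b c u v∈live (there (here u≡v)) = proj₂ (proj₂ (live-sound (c ∷ u ∷ []) b v∈live)) (there (here (sym u≡v)))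

edge-survives : ∀ b c u {v z} → v ∈ live (c ∷ u ∷ []) b → z ∉ center b ∷ v ∷ [] → v ∈ live (c ∷ z ∷ []) b
edge-survives b c u {v} {z} v∈live z∉ = live-complete (c ∷ z ∷ []) b center∉ v∈leaves v∉
  where
  sound = live-sound (c ∷ u ∷ []) b v∈live
  v∈leaves = proj₁ (proj₂ sound)
  center∉ : center b ∉ c ∷ z ∷ []
  center∉ (here c≡)           = proj₁ sound (here c≡)
  center∉ (there (here c≡z)) = z∉ (here (sym c≡z))
  v∉ : v ∉ c ∷ z ∷ []
  v∉ (here v≡c)           = proj₂ (proj₂ sound) (here v≡c)
  v∉ (there (here v≡z)) = z∉ (there (here (sym v≡z)))

one-bush-≥ : ∀ {b R v} → v ∈ live R b → weight b ≤ expectedRgma (b ∷ []) R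
one-bush-≥ {b} {R} v∈live with live R b
... | l ∷ ls = avg-map-≥-pointwise (λ _ → weight b + 0ℚ) {l} {ls} (λ _ → ≤-reflexive (sym (+-identityʳ (weight b))))

one-bush-nonneg : ∀ {b R} → 0ℚ ≤ weight b → 0ℚ ≤ expectedRgma (b ∷ []) R
one-bush-nonneg {b} {R} w≥0 with live R b
... | []     = ≤-refl
... | l ∷ ls = avg-map-≥-pointwise (λ _ → weight b + 0ℚ) {l} {ls}
                 (λ _ → ≤-trans w≥0 (≤-reflexive (sym (+-identityʳ (weight b)))))

second-gain : Bush → ℕ → ℕ → ℚ
second-gain b c z = expectedRgma (b ∷ []) (c ∷ z ∷ [])

second-gain-nonneg : ∀ {b c} → 0ℚ ≤ weight b → ∀ z → 0ℚ ≤ second-gain b c z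
second-gain-nonneg {b} {c} w≥0 z = one-bush-nonneg {b} {c ∷ z ∷ []} w≥0

rgma-first-bush : ∀ {c l ls w} bs → expectedRgma (bush c (l ∷ ls) w ∷ bs) [] ≡
  avg (map (λ z → w + expectedRgma bs (c ∷ z ∷ [])) (l ∷ ls))
rgma-first-bush {c} {l} {ls} {w} bs =
  cong (λ leaves → avg (map (λ z → w + expectedRgma bs (c ∷ z ∷ [])) (l ∷ leaves)))
       (filter-all (T? ∘ λ u → not (memᵇ u [])) (All.universal _ ls))

data FirstBush (b : Bush) (bs : List Bush) (R : List ℕ) : ℚ → Set where
  skipped : ∀ {x} → live R b ≡ [] → GreedyRun bs R x → FirstBush b bs R x
  picked  : ∀ {u y} → u ∈ live R b → GreedyRun bs (center b ∷ u ∷ R) y →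
            FirstBush b bs R (weight b + y)

-- Every greedy run has this shape: a second pick from b would need a live
-- edge of b although its center is already deleted.
greedy-first : ∀ {b bs R x} → GreedyRun (b ∷ bs) R x → FirstBush b bs R x
greedy-first (next none run) = skipped none run
greedy-first {b} {R = R} (pick {u = u} u∈live run) with greedy-first run
... | skipped _ rest    = picked u∈live rest
... | picked v∈live _ = ⊥-elim (center-deleted b {u} {R} v∈live)

theorem8 : (b₁ b₂ : Bush) → WellFormedBush b₁ → WellFormedBush b₂ →
           EdgeDisjoint b₁ b₂ → 0ℚ < weight b₂ → weight b₂ < weight b₁ →
           ∀ x → GreedyRun (b₁ ∷ b₂ ∷ []) [] x →
           ((+ 2) / 3) * x ≤ expectedRgma (b₁ ∷ b₂ ∷ []) []
theorem8 (bush c₁ [] w₁) _ wf₁ _ _ _ _ _ _ = ⊥-elim (WellFormedBush.nonempty wf₁ refl)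
theorem8 b₁@(bush c₁ (l ∷ ls) w₁) b₂ wf₁ _ _ w₂>0 w₂<w₁ _ run
  rewrite rgma-first-bush {c₁} {l} {ls} {w₁} (b₂ ∷ [])
  with greedy-first run
... | skipped () _
... | picked {u} u∈live run₂ with greedy-first run₂
...   | skipped _ done =
  one-pick-bound (second-gain b₂ c₁) {l} {ls} (≤-trans w₂≥0 (<⇒≤ w₂<w₁)) (second-gain-nonneg {b₂} {c₁} w₂≥0)
  where w₂≥0 = <⇒≤ w₂>0
...   | picked v∈live done =
  Exceptions.two-picks-bound ℕ._≟_ (second-gain b₂ c₁) {l = l} {ls} w₂≥0 (<⇒≤ w₂<w₁)
    (WellFormedBush.distinct wf₁)
    (proj₁ (proj₂ (live-sound [] b₁ u∈live)))
    (picked-not-endpoint b₂ c₁ u v∈live)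
    (second-gain-nonneg {b₂} {c₁} w₂≥0)
    (λ z z∉ → one-bush-≥ {b₂} {c₁ ∷ z ∷ []} (edge-survives b₂ c₁ u v∈live z∉))
  where w₂≥0 = <⇒≤ w₂>0
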